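{- Let $\rho_1,\rho_2,\dots$ be nonzero parameters, put $\beta_j=\rho_{j+1}$ for $j\ge1$, and let $U_j=\kappa_j+\Theta_j$ be the blocking operators with $\boldsymbol{\alpha}=0$ and these $\boldsymbol{\beta}$. Then for every partition $\mu$ and every finite sequence $(j_1,\dots,j_k)$ of positive integers, $U_{j_1}U_{j_2}\cdots U_{j_k}\cdot\mu=\dfrac{\rho_{j_1}\rho_{j_2}\cdots\rho_{j_k}}{\boldsymbol{\rho}^{\lambda/\mu}}\cdot\lambda$, where $\lambda$ is the partition of which $U_{j_1}\cdots U_{j_k}\cdot\mu$ is a scalar multiple.
   Context: $\mathcal{P}$ is the set of partitions (infinite weakly decreasing sequences of nonnegative integers with finitely many nonzero terms), with the convention $\lambda_0=\infty$, and $\mathbf{k}[\mathcal{P}]$ the vector space with basis $\mathcal{P}$ over a field $\mathbf{k}$ of characteristic $0$ containing the parameters. For $i\ge1$: $\kappa_i\cdot\lambda$ is the partition obtained by adding a box to row $i$ if $\lambda_i<\lambda_{i-1}$, and $0$ otherwise; with $\boldsymbol{\alpha}=0$, $\Theta_i\cdot\lambda=0$ if $\lambda_i<\lambda_{i-1}$ and $\Theta_i\cdot\lambda=\beta_{i-1}\lambda$ if $\lambda_i=\lambda_{i-1}$. Notation: $\boldsymbol{\rho}^{\lambda/\mu}=\prod_r\rho_r^{\lambda_r-\mu_r}$. -}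

module Defs where

open import Level using (Level; _⊔_) renaming (suc to lsuc)
open import Algebra.Bundles using (CommutativeRing)
open import Data.Nat as ℕ using (ℕ; zero; suc; _<_; _≤_; _≟_)
open import Data.List using (List; []; _∷_; _++_; concatMap; map; foldr; length)
open import Data.List.Properties using (≡-dec)
open import Data.List.Relation.Unary.All using (All)
open import Data.List.Relation.Unary.Linked using (Linked)
open import Data.Product using (_×_; _,_)
open import Relation.Nullary using (¬_; yes; no)
open import Relation.Binary.PropositionalEquality using (_≡_)

-- Fields (with a total inverse, 0⁻¹ unconstrained) of characteristic 0

record Field (c ℓ : Level) : Set (lsuc (c ⊔ ℓ)) where
  field
    commutativeRing : CommutativeRing c ℓ
  open CommutativeRing commutativeRing public
  field
    _⁻¹        : Carrier → Carrier
    inverseʳ   : ∀ x → ¬ (x ≈ 0#) → (x * (x ⁻¹)) ≈ 1#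
    1≉0        : ¬ (1# ≈ 0#)

  ofℕ : ℕ → Carrier
  ofℕ zero    = 0#
  ofℕ (suc n) = 1# + ofℕ n

  _^_ : Carrier → ℕ → Carrier
  x ^ zero  = 1#
  x ^ suc n = x * (x ^ n)

CharZero : ∀ {c ℓ} → Field c ℓ → Set ℓ
CharZero F = ∀ n → ¬ (ofℕ (suc n) ≈ 0#)
  where open Field F

-- Partitions: a partition λ = (λ₁ ≥ λ₂ ≥ … ) is represented by the
-- list of its nonzero parts [λ₁, λ₂, …, λ_ℓ]; λ_r = 0 for r > ℓ.

IsPartition : List ℕ → Set
IsPartition xs = Linked (λ a b → b ≤ a) xs × All (λ a → 1 ≤ a) xs

-- λ_r for r ≥ 1 (1-indexed); rows beyond the length are 0
part : List ℕ → ℕ → ℕ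
part []       _             = 0
part (x ∷ xs) zero          = 0   -- row 0 is never queried via part (λ₀ = ∞)
part (x ∷ xs) (suc zero)    = x
part (x ∷ xs) (suc (suc r)) = part xs (suc r)

-- add a box to row i (i ≥ 1); only used when λ_i < λ_{i-1}
addBox : List ℕ → ℕ → List ℕ
addBox xs       zero          = xs          -- unused (no row 0)
addBox []       (suc zero)    = 1 ∷ []
addBox (x ∷ xs) (suc zero)    = suc x ∷ xs
addBox []       (suc (suc i)) = []          -- unreachable: λ_i = λ_{i-1} = 0
addBox (x ∷ xs) (suc (suc i)) = x ∷ addBox xs (suc i)

-- The vector space k[P]: finite formal linear combinations of
-- (list representations of) partitions, compared coefficientwise.

module _ {c ℓ} (F : Field c ℓ) where
  open Field F

  Vect : Set c
  Vect = List (Carrier × List ℕ)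

  _·ᵥ_ : Carrier → List ℕ → Vect
  a ·ᵥ ν = (a , ν) ∷ []

  scaleᵥ : Carrier → Vect → Vect
  scaleᵥ a = map (λ { (b , ν) → (a * b , ν) })

  coeff : Vect → List ℕ → Carrier
  coeff []             ν = 0#
  coeff ((a , ν') ∷ v) ν with ≡-dec _≟_ ν' ν
  ... | yes _ = a + coeff v ν
  ... | no  _ = coeff v ν

  _≈ᵥ_ : Vect → Vect → Set ℓ
  v ≈ᵥ w = ∀ ν → coeff v ν ≈ coeff w ν

  linExt : (List ℕ → Vect) → Vect → Vect
  linExt f = concatMap (λ { (a , ν) → scaleᵥ a (f ν) })

  κ : ℕ → List ℕ → Vect
  κ zero          ν = []
  κ (suc zero)    ν = 1# ·ᵥ addBox ν 1
  κ (suc (suc i)) ν with part ν (suc (suc i)) ℕ.<? part ν (suc i)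
  ... | yes _ = 1# ·ᵥ addBox ν (suc (suc i))
  ... | no  _ = []

  -- Θ_i · λ with α = 0 and parameters β = (β₁, β₂, …) given by β j = β_j
  Θ : (ℕ → Carrier) → ℕ → List ℕ → Vect
  Θ β zero          ν = []
  Θ β (suc zero)    ν = []          -- λ₁ < λ₀ = ∞ always
  Θ β (suc (suc i)) ν with part ν (suc (suc i)) ≟ part ν (suc i)
  ... | yes _ = β (suc i) ·ᵥ ν
  ... | no  _ = []

  U : (ℕ → Carrier) → ℕ → List ℕ → Vect
  U β i ν = κ i ν ++ Θ β i ν

  Uword : (ℕ → Carrier) → List ℕ → List ℕ → Vect
  Uword β js μ = foldr (λ j v → linExt (U β j) v) (1# ·ᵥ μ) js

  ρprod : (ℕ → Carrier) → List ℕ → Carrier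
  ρprod ρ js = foldr (λ j a → ρ j * a) 1# js

  ρpowFrom : (ℕ → Carrier) → ℕ → List ℕ → Carrier
  ρpowFrom ρ r []       = 1#
  ρpowFrom ρ r (x ∷ xs) = (ρ r ^ x) * ρpowFrom ρ (suc r) xs

  ρpow : (ℕ → Carrier) → List ℕ → Carrier
  ρpow ρ = ρpowFrom ρ 1

  -- ρ^{λ/μ} = ∏_r ρ_r^{λ_r - μ_r} (integer exponents)
  ρquot : (ℕ → Carrier) → List ℕ → List ℕ → Carrier
  ρquot ρ λ' μ = ρpow ρ λ' * (ρpow ρ μ ⁻¹)

{-# OPTIONS --safe #-}
-- Each U_j maps a partition ν to a single scaled partition: either
-- κ_j adds a box to row j, multiplying ρ^ν by ρ_j, or row j cannot
-- grow, in which case Θ_j scales ν by β_{j-1} = ρ_j.  Hence every word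
-- U_{j₁} ⋯ U_{j_k} sends μ to a · λ with a ρ^λ = ρ_{j₁} ⋯ ρ_{j_k} ρ^μ,
-- and dividing by ρ^λ / ρ^μ gives the coefficient.  Characteristic 0 is
-- not needed.
module Submission where

open import Defs
open import Level using (_⊔_)
open import Data.Nat as ℕ using (ℕ; zero; suc; _≤_; _<_; _<?_; _≟_; z≤n; s≤s)
open import Data.Nat.Properties as ℕ using (m≤n⇒m≤1+n; <-irrefl; ≤∧≢⇒<)
open import Data.List using (List; []; _∷_)
open import Data.List.Properties using (≡-dec)
open import Data.List.Relation.Unary.All using (All; []; _∷_)
open import Data.List.Relation.Unary.Linked using (Linked; [-]; _∷_)
open import Data.Product using (Σ; _×_; _,_; proj₁)
open import Data.Unit using (⊤; tt)
open import Data.Empty using (⊥; ⊥-elim)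
open import Relation.Nullary using (¬_; yes; no)
open import Relation.Binary.PropositionalEquality as ≡ using (_≡_)

Decreasing : List ℕ → Set
Decreasing = Linked (λ a b → b ≤ a)

Positive : List ℕ → Set
Positive = All (1 ≤_)

-- A box can be added to row r ≥ 1 of ν (rows are 1-indexed, λ₀ = ∞).
Addable : List ℕ → ℕ → Set
Addable ν zero          = ⊥
Addable ν (suc zero)    = ⊤
Addable ν (suc (suc i)) = part ν (suc (suc i)) < part ν (suc i)

Addable-tail : ∀ x xs i → Addable (x ∷ xs) (suc (suc i)) → Addable xs (suc i)
Addable-tail x xs zero    _ = tt
Addable-tail x xs (suc i) h = h

part-antitone : ∀ ν i → Decreasing ν → part ν (suc (suc i)) ≤ part ν (suc i)
part-antitone []           i       _        = z≤n
part-antitone (x ∷ [])     zero    _        = z≤n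
part-antitone (x ∷ [])     (suc i) _        = z≤n
part-antitone (x ∷ y ∷ ys) zero    (y≤x ∷ _) = y≤x
part-antitone (x ∷ y ∷ ys) (suc i) (_ ∷ d)   = part-antitone (y ∷ ys) i d

addBox-decreasing : ∀ ν r → Decreasing ν → Positive ν → Addable ν r → Decreasing (addBox ν r)
addBox-decreasing []           (suc zero)          _         _           _ = [-]
addBox-decreasing (x ∷ [])     (suc zero)          _         _           _ = [-]
addBox-decreasing (x ∷ y ∷ ys) (suc zero)          (y≤x ∷ d) _           _ = m≤n⇒m≤1+n y≤x ∷ d
addBox-decreasing (x ∷ [])     (suc (suc zero))    _         (1≤x ∷ _)   _ = 1≤x ∷ [-]
addBox-decreasing (x ∷ y ∷ ys) (suc (suc zero))    (_ ∷ d)   (_ ∷ p)     h =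
  h ∷ addBox-decreasing (y ∷ ys) 1 d p tt
addBox-decreasing (x ∷ y ∷ ys) (suc (suc (suc i))) (y≤x ∷ d) (_ ∷ p)     h =
  y≤x ∷ addBox-decreasing (y ∷ ys) (suc (suc i)) d p h

addBox-positive : ∀ ν r → Positive ν → Addable ν r → Positive (addBox ν r)
addBox-positive []       (suc zero)    _       _ = s≤s z≤n ∷ []
addBox-positive (x ∷ xs) (suc zero)    (_ ∷ p) _ = s≤s z≤n ∷ p
addBox-positive (x ∷ xs) (suc (suc i)) (q ∷ p) h = q ∷ addBox-positive xs (suc i) p (Addable-tail x xs i h)

addBox-isPartition : ∀ ν r → IsPartition ν → Addable ν r → IsPartition (addBox ν r)
addBox-isPartition ν r (d , p) h = addBox-decreasing ν r d p h , addBox-positive ν r p h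

module _ {c ℓ} (F : Field c ℓ) where
  open Field F
  open import Relation.Binary.Reasoning.Setoid setoid
  open import Algebra.Properties.CommutativeSemigroup *-commutativeSemigroup using (x∙yz≈y∙xz)

  ·ᵥ-cong : ∀ {a b} ν → a ≈ b → _≈ᵥ_ F (_·ᵥ_ F a ν) (_·ᵥ_ F b ν)
  ·ᵥ-cong ν a≈b ν′ with ≡-dec _≟_ ν ν′
  ... | yes _ = +-congʳ a≈b
  ... | no  _ = refl

  *-nonzero : ∀ {x y} → ¬ x ≈ 0# → ¬ y ≈ 0# → ¬ x * y ≈ 0#
  *-nonzero {x} {y} x≉0 y≉0 xy≈0 = y≉0 (begin
    y                 ≈⟨ *-identityˡ y ⟨
    1# * y            ≈⟨ *-congʳ (inverseʳ x x≉0) ⟨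
    (x * x ⁻¹) * y    ≈⟨ *-congʳ (*-comm x (x ⁻¹)) ⟩
    (x ⁻¹ * x) * y    ≈⟨ *-assoc (x ⁻¹) x y ⟩
    x ⁻¹ * (x * y)    ≈⟨ *-congˡ xy≈0 ⟩
    x ⁻¹ * 0#         ≈⟨ zeroʳ (x ⁻¹) ⟩
    0#                ∎)

  ⁻¹-nonzero : ∀ {x} → ¬ x ≈ 0# → ¬ x ⁻¹ ≈ 0#
  ⁻¹-nonzero {x} x≉0 x⁻¹≈0 = 1≉0 (begin
    1#          ≈⟨ inverseʳ x x≉0 ⟨
    x * x ⁻¹    ≈⟨ *-congˡ x⁻¹≈0 ⟩
    x * 0#      ≈⟨ zeroʳ x ⟩
    0#          ∎)

  ^-nonzero : ∀ {x} → ¬ x ≈ 0# → ∀ n → ¬ x ^ n ≈ 0#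
  ^-nonzero x≉0 zero    = 1≉0
  ^-nonzero x≉0 (suc n) = *-nonzero x≉0 (^-nonzero x≉0 n)

  x*y≈z⇒x≈z*y⁻¹ : ∀ {x y z} → ¬ y ≈ 0# → x * y ≈ z → x ≈ z * y ⁻¹
  x*y≈z⇒x≈z*y⁻¹ {x} {y} {z} y≉0 xy≈z = begin
    x                 ≈⟨ *-identityʳ x ⟨
    x * 1#            ≈⟨ *-congˡ (inverseʳ y y≉0) ⟨
    x * (y * y ⁻¹)    ≈⟨ *-assoc x y (y ⁻¹) ⟨
    (x * y) * y ⁻¹    ≈⟨ *-congʳ xy≈z ⟩
    z * y ⁻¹          ∎

  x*y≈z*w⇒x*[y*w⁻¹]≈z : ∀ {x y z w} → ¬ w ≈ 0# → x * y ≈ z * w → x * (y * w ⁻¹) ≈ z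
  x*y≈z*w⇒x*[y*w⁻¹]≈z {x} {y} {z} {w} w≉0 xy≈zw = begin
    x * (y * w ⁻¹)    ≈⟨ *-assoc x y (w ⁻¹) ⟨
    (x * y) * w ⁻¹    ≈⟨ *-congʳ xy≈zw ⟩
    (z * w) * w ⁻¹    ≈⟨ *-assoc z w (w ⁻¹) ⟩
    z * (w * w ⁻¹)    ≈⟨ *-congˡ (inverseʳ w w≉0) ⟩
    z * 1#            ≈⟨ *-identityʳ z ⟩
    z                 ∎

  module _ (ρ : ℕ → Carrier) where

    ρpowFrom-nonzero : (∀ r → 1 ≤ r → ¬ ρ r ≈ 0#) →
                       ∀ s → 1 ≤ s → ∀ ν → ¬ ρpowFrom F ρ s ν ≈ 0#
    ρpowFrom-nonzero ρ≉0 s 1≤s []       = 1≉0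
    ρpowFrom-nonzero ρ≉0 s 1≤s (x ∷ xs) =
      *-nonzero (^-nonzero (ρ≉0 s 1≤s) x) (ρpowFrom-nonzero ρ≉0 (suc s) (m≤n⇒m≤1+n 1≤s) xs)

    ρpowFrom-addBox : ∀ s ν i → Addable ν (suc i) →
                      ρpowFrom F ρ s (addBox ν (suc i)) ≈ ρ (s ℕ.+ i) * ρpowFrom F ρ s ν
    ρpowFrom-addBox s []       zero    _ rewrite ℕ.+-identityʳ s = *-congʳ (*-identityʳ (ρ s))
    ρpowFrom-addBox s (x ∷ xs) zero    _ rewrite ℕ.+-identityʳ s = *-assoc (ρ s) (ρ s ^ x) _
    ρpowFrom-addBox s (x ∷ xs) (suc i) h rewrite ℕ.+-suc s i = begin
      (ρ s ^ x) * ρpowFrom F ρ (suc s) (addBox xs (suc i))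
        ≈⟨ *-congˡ (ρpowFrom-addBox (suc s) xs i (Addable-tail x xs i h)) ⟩
      (ρ s ^ x) * (ρ (suc s ℕ.+ i) * ρpowFrom F ρ (suc s) xs)
        ≈⟨ x∙yz≈y∙xz _ _ _ ⟩
      ρ (suc s ℕ.+ i) * ((ρ s ^ x) * ρpowFrom F ρ (suc s) xs) ∎

    record BalancedTerm (v : Vect F) (k : Carrier) (μ : List ℕ) : Set (c ⊔ ℓ) where
      field
        coefficient : Carrier
        shape       : List ℕ
        isTerm      : v ≡ _·ᵥ_ F coefficient shape
        isPartition : IsPartition shape
        balanced    : coefficient * ρpow F ρ shape ≈ k * ρpow F ρ μ

    open BalancedTerm

    β : ℕ → Carrier
    β j = ρ (suc j)

    U-balanced : ∀ j → 1 ≤ j → ∀ ν → IsPartition ν → BalancedTerm (U F β j ν) (ρ j) ν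
    U-balanced (suc zero) _ ν pν = record
      { coefficient = 1# ; shape = addBox ν 1 ; isTerm = ≡.refl
      ; isPartition = addBox-isPartition ν 1 pν tt
      ; balanced    = trans (*-identityˡ _) (ρpowFrom-addBox 1 ν 0 tt) }
    -- Since rows weakly decrease, exactly one of κ_j and Θ_j acts.
    U-balanced (suc (suc i)) _ ν pν
      with part ν (suc (suc i)) <? part ν (suc i) | part ν (suc (suc i)) ≟ part ν (suc i)
    ... | yes lt  | yes eq  = ⊥-elim (<-irrefl eq lt)
    ... | no ¬lt  | no ¬eq  = ⊥-elim (¬lt (≤∧≢⇒< (part-antitone ν i (proj₁ pν)) ¬eq))
    ... | yes lt  | no _    = record
      { coefficient = 1# ; shape = addBox ν (suc (suc i)) ; isTerm = ≡.refl
      ; isPartition = addBox-isPartition ν (suc (suc i)) pν lt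
      ; balanced    = trans (*-identityˡ _) (ρpowFrom-addBox 1 ν (suc i) lt) }
    ... | no _    | yes _   = record
      { coefficient = ρ (suc (suc i)) ; shape = ν ; isTerm = ≡.refl
      ; isPartition = pν ; balanced = refl }

    linExt-balanced : ∀ {f v k k′ μ} → (∀ ν → IsPartition ν → BalancedTerm (f ν) k′ ν) →
                      BalancedTerm v k μ → BalancedTerm (linExt F f v) (k′ * k) μ
    linExt-balanced {f} {v} {k} {k′} {μ} f-balanced t = record
      { coefficient = a * b ; shape = shape t′ ; isTerm = isTerm′
      ; isPartition = isPartition t′ ; balanced = balanced′ }
      where
      t′ : BalancedTerm (f (shape t)) k′ (shape t)
      t′ = f-balanced (shape t) (isPartition t)

      a b : Carrier
      a = coefficient t
      b = coefficient t′

      isTerm′ : linExt F f v ≡ _·ᵥ_ F (a * b) (shape t′)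
      isTerm′ rewrite isTerm t | isTerm t′ = ≡.refl

      balanced′ : (a * b) * ρpow F ρ (shape t′) ≈ (k′ * k) * ρpow F ρ μ
      balanced′ = begin
        (a * b) * ρpow F ρ (shape t′)   ≈⟨ *-assoc a b _ ⟩
        a * (b * ρpow F ρ (shape t′))   ≈⟨ *-congˡ (balanced t′) ⟩
        a * (k′ * ρpow F ρ (shape t))   ≈⟨ x∙yz≈y∙xz _ _ _ ⟩
        k′ * (a * ρpow F ρ (shape t))   ≈⟨ *-congˡ (balanced t) ⟩
        k′ * (k * ρpow F ρ μ)           ≈⟨ *-assoc _ _ _ ⟨
        (k′ * k) * ρpow F ρ μ           ∎

    Uword-balanced : ∀ μ → IsPartition μ → ∀ js → All (1 ≤_) js →
                     BalancedTerm (Uword F β js μ) (ρprod F ρ js) μ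
    Uword-balanced μ pμ []       _          = record
      { coefficient = 1# ; shape = μ ; isTerm = ≡.refl ; isPartition = pμ ; balanced = refl }
    Uword-balanced μ pμ (j ∷ js) (1≤j ∷ ps) =
      linExt-balanced (U-balanced j 1≤j) (Uword-balanced μ pμ js ps)

    BalancedTerm⇒≈ᵥ : (∀ r → 1 ≤ r → ¬ ρ r ≈ 0#) → ∀ {v k μ} (t : BalancedTerm v k μ) →
                      _≈ᵥ_ F v (_·ᵥ_ F (k * ρquot F ρ (shape t) μ ⁻¹) (shape t))
    BalancedTerm⇒≈ᵥ ρ≉0 {μ = μ} t rewrite isTerm t =
      ·ᵥ-cong (shape t) (x*y≈z⇒x≈z*y⁻¹ (*-nonzero ρ^λ≉0 (⁻¹-nonzero ρ^μ≉0))
                          (x*y≈z*w⇒x*[y*w⁻¹]≈z ρ^μ≉0 (balanced t)))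
      where
      ρ^λ≉0 : ¬ ρpow F ρ (shape t) ≈ 0#
      ρ^λ≉0 = ρpowFrom-nonzero ρ≉0 1 (s≤s z≤n) (shape t)
      ρ^μ≉0 : ¬ ρpow F ρ μ ≈ 0#
      ρ^μ≉0 = ρpowFrom-nonzero ρ≉0 1 (s≤s z≤n) μ

lemma4p6 : ∀ {c ℓ} (F : Field c ℓ) → CharZero F →
    let open Field F in
    (ρ : ℕ → Carrier) → (∀ r → 1 ≤ r → ¬ (ρ r ≈ 0#)) →
    (μ : List ℕ) → IsPartition μ →
    (js : List ℕ) → All (λ j → 1 ≤ j) js →
    Σ (List ℕ) λ lam → IsPartition lam ×
      _≈ᵥ_ F (Uword F (λ j → ρ (suc j)) js μ)
             (_·ᵥ_ F (ρprod F ρ js * (ρquot F ρ lam μ ⁻¹)) lam)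
lemma4p6 F _ ρ ρ≉0 μ pμ js pjs =
  BalancedTerm.shape word , BalancedTerm.isPartition word , BalancedTerm⇒≈ᵥ F ρ ρ≉0 word
  where
  word : BalancedTerm F ρ (Uword F (λ j → ρ (suc j)) js μ) (ρprod F ρ js) μ
  word = Uword-balanced F ρ μ pμ js pjs
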